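{- For the 2-server problem on the circle, the greedy algorithm (with any tie-breaking rule) is bijectively optimal: for every $n$ and every online algorithm $B$ there is a bijection $\pi:\mathcal{I}_n\to\mathcal{I}_n$ with $\textsc{greedy}(\sigma)\le B(\pi(\sigma))$ for all $\sigma\in\mathcal{I}_n$.
   Context: The continuous circle (of unit circumference) is modelled by a cycle whose vertices are equally spaced (all edges of equal, arbitrarily small length). Two servers occupy vertices; a request is a vertex, and an algorithm must move a server to the requested vertex; the cost is the total distance travelled by the servers. All algorithms start from the same given initial configuration. $\mathcal{I}_n$ is the set of all request sequences of length $n$ and $A(\sigma)$ is the cost of $A$ on $\sigma$. $\textsc{greedy}$ serves each request by moving the server closest to it (only that server moves). -}

module Defs where

open import Data.Nat using (ℕ; suc; _+_; _∸_; _≤_; _⊓_)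
open import Data.Fin using (Fin; toℕ)
open import Data.List using (List; []; _∷_)
open import Data.Vec using (Vec; []; _∷_)
open import Data.Product using (_×_; _,_)
open import Data.Sum using (_⊎_)
open import Relation.Binary.PropositionalEquality using (_≡_)

-- The circle discretised as a cycle on N vertices 0,…,N-1 (edge length 1/N;
-- all distances below are measured in edges, i.e. scaled by N).

absDiff : ℕ → ℕ → ℕ
absDiff i j = (i ∸ j) + (j ∸ i)

cdist : {N : ℕ} → Fin N → Fin N → ℕ
cdist {N} i j = absDiff (toℕ i) (toℕ j) ⊓ (N ∸ absDiff (toℕ i) (toℕ j))

Config : ℕ → Set
Config N = Fin N × Fin N

moveCost : {N : ℕ} → Config N → Config N → ℕ
moveCost (a , b) (a' , b') = cdist a a' + cdist b b'

Covers : {N : ℕ} → Config N → Fin N → Set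
Covers (a , b) r = (a ≡ r) ⊎ (b ≡ r)

-- A deterministic online algorithm: given the past requests (newest first)
-- and the current request, it chooses the new configuration, which must
-- have a server on the request.  (Its current configuration is a function
-- of the past requests, since all algorithms start from the same given
-- initial configuration.)
record Online (N : ℕ) : Set where
  field
    step   : List (Fin N) → Fin N → Config N
    serves : ∀ past r → Covers (step past r) r
open Online public

conf : {N : ℕ} → Online N → Config N → List (Fin N) → Config N
conf A c0 []         = c0
conf A c0 (r ∷ past) = step A past r

runCost : {N n : ℕ} → Online N → Config N → List (Fin N) → Vec (Fin N) n → ℕ
runCost A c0 past []       = 0
runCost A c0 past (r ∷ rs) =
  moveCost (conf A c0 past) (step A past r) + runCost A c0 (r ∷ past) rs

cost : {N n : ℕ} → Online N → Config N → Vec (Fin N) n → ℕ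
cost A c0 σ = runCost A c0 [] σ

-- A is a greedy algorithm (with an arbitrary, possibly history-dependent,
-- tie-breaking rule): it moves only a server closest to the request.
IsGreedy : {N : ℕ} → Online N → Config N → Set
IsGreedy {N} A c0 = ∀ (past : List (Fin N)) (r : Fin N) →
  GreedyStep (conf A c0 past) r (step A past r)
  where
  GreedyStep : Config N → Fin N → Config N → Set
  GreedyStep (a , b) r c' =
    (cdist a r ≤ cdist b r × c' ≡ (r , b)) ⊎ (cdist b r ≤ cdist a r × c' ≡ (a , r))

-- Greedy is compared with B one request at a time.  If both serve the first
-- request r from the common configuration x, greedy reaching z and B reaching
-- y, then some isometry T of the circle (a rotation or a reflection) satisfies
-- move x z + move z (T y) ≤ move x y.  By induction, greedy continuing from z
-- is bijectively dominated by the rest of B transported by T and started at z;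
-- starting that transported strategy at T y instead costs at most
-- move z (T y) more, and undoing T, which relabels the remaining requests
-- bijectively, turns it back into B continuing from y.  The bijections for
-- the different first requests combine into one on request sequences.

module Submission where

open import Defs
open import Data.Nat as ℕ using (ℕ; zero; suc; _≤_; _∸_; _⊓_; z≤n)
import Data.Nat.Properties as ℕ
open import Algebra.Properties.CommutativeSemigroup ℕ.+-commutativeSemigroup using (interchange)
open import Data.Integer as ℤ using (ℤ; +_; -[1+_]; +[1+_]; ∣_∣; _⊖_; _-_; -_; 0ℤ; 1ℤ; -1ℤ)
import Data.Integer.Properties as ℤ
open import Data.Integer.DivMod using (_%ℕ_; _/ℕ_; a≡a%ℕn+[a/ℕn]*n; n%ℕd<d)
open import Data.Integer.Tactic.RingSolver using (solve-∀)
open import Data.Fin using (Fin; toℕ; fromℕ<)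
import Data.Fin.Properties as Fin
open import Data.List using (List; []; _∷_)
open import Data.Vec using (Vec; []; _∷_; map)
open import Data.Vec.Properties using (map-∘; map-id; map-cong)
open import Data.Product using (Σ; ∃-syntax; _×_; _,_; proj₁; proj₂)
open import Data.Sum using (_⊎_; inj₁; inj₂)
open import Data.Unit using (⊤; tt)
open import Data.Empty using (⊥-elim)
open import Function using (id; _∘_)
open import Function.Bundles using (_↔_; Inverse; mk↔ₛ′)
open import Function.Construct.Identity using (↔-id)
open import Function.Construct.Composition using (_↔-∘_)
open import Function.Construct.Symmetry using (↔-sym)
open import Relation.Nullary using (yes; no)
open import Relation.Binary.Bundles using (Setoid)
import Relation.Binary.Reasoning.Setoid as SetoidReasoning
open import Relation.Binary.PropositionalEquality

absDiff-comm : ∀ m n → absDiff m n ≡ absDiff n m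
absDiff-comm m n = ℕ.+-comm (m ∸ n) (n ∸ m)

absDiff-≤ : ∀ {m n} → m ℕ.≤ n → absDiff m n ≡ n ∸ m
absDiff-≤ {m} {n} m≤n = cong (ℕ._+ (n ∸ m)) (ℕ.m≤n⇒m∸n≡0 m≤n)

absDiff-≥ : ∀ {m n} → n ℕ.≤ m → absDiff m n ≡ m ∸ n
absDiff-≥ {m} {n} n≤m = trans (absDiff-comm m n) (absDiff-≤ n≤m)

absDiff-< : ∀ {m n o} → m ℕ.< o → n ℕ.< o → absDiff m n ℕ.< o
absDiff-< {m} {n} m<o n<o with ℕ.≤-total m n
... | inj₁ m≤n rewrite absDiff-≤ m≤n = ℕ.≤-<-trans (ℕ.m∸n≤m n m) n<o
... | inj₂ n≤m rewrite absDiff-≥ n≤m = ℕ.≤-<-trans (ℕ.m∸n≤m m n) m<o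

∷-↔ : ∀ {A : Set} {n} → (A → Vec A n ↔ Vec A n) → Vec A (suc n) ↔ Vec A (suc n)
∷-↔ {A} {n} π = mk↔ₛ′ to′ from′ to∘from from∘to
  where
  to′ from′ : Vec A (suc n) → Vec A (suc n)
  to′ (x ∷ xs) = x ∷ Inverse.to (π x) xs
  from′ (x ∷ xs) = x ∷ Inverse.from (π x) xs
  to∘from : ∀ xs → to′ (from′ xs) ≡ xs
  to∘from (x ∷ xs) = cong (x ∷_) (Inverse.strictlyInverseˡ (π x) xs)
  from∘to : ∀ xs → from′ (to′ xs) ≡ xs
  from∘to (x ∷ xs) = cong (x ∷_) (Inverse.strictlyInverseʳ (π x) xs)

map-inverse : ∀ {A B : Set} {g : A → B} {h : B → A} {n} → g ∘ h ≗ id → map {n = n} g ∘ map h ≗ id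
map-inverse {g = g} {h} g∘h≗id ys = trans (sym (map-∘ g h ys)) (trans (map-cong g∘h≗id ys) (map-id ys))

map-↔ : ∀ {A B : Set} {n} → A ↔ B → Vec A n ↔ Vec B n
map-↔ f = mk↔ₛ′ (map to) (map from) (map-inverse strictlyInverseˡ) (map-inverse strictlyInverseʳ)
  where open Inverse f

-- Two servers on a pseudometric space

module TwoServers {P : Set} (d : P → P → ℕ) where

  open import Data.Nat using (_+_)

  Conf : Set
  Conf = P × P

  move : Conf → Conf → ℕ
  move (a , b) (a′ , b′) = d a a′ + d b b′

  Serves : Conf → P → Set
  Serves (a , b) r = (a ≡ r) ⊎ (b ≡ r)

  GreedyMove : Conf → P → Conf → Set
  GreedyMove (a , b) r c = (d a r ≤ d b r × c ≡ (r , b)) ⊎ (d b r ≤ d a r × c ≡ (a , r))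

  record Reply (r : P) (S : Set) : Set where
    constructor reply
    field
      next        : Conf
      next-serves : Serves next r
      rest        : S
  open Reply public

  Strategy : ℕ → Set
  Strategy zero    = ⊤
  Strategy (suc n) = (r : P) → Reply r (Strategy n)

  serveCost : ∀ {n} → Conf → Strategy n → Vec P n → ℕ
  serveCost x s []      = 0
  serveCost x s (r ∷ σ) = move x (next (s r)) + serveCost (next (s r)) (rest (s r)) σ

  Greedy : ∀ {n} → Conf → Strategy n → Set
  Greedy {zero}  x s = ⊤
  Greedy {suc n} x s = ∀ r → GreedyMove x r (next (s r)) × Greedy (next (s r)) (rest (s r))

  record Isometry : Set where
    field
      bijection : P ↔ P
      isometric : ∀ x y → d (Inverse.to bijection x) (Inverse.to bijection y) ≡ d x y
    open Inverse bijection public using (to; from; strictlyInverseˡ; strictlyInverseʳ)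
  open Isometry public

  id-isometry : Isometry
  id-isometry = record { bijection = ↔-id P ; isometric = λ _ _ → refl }

  _·_ : Isometry → Conf → Conf
  T · (a , b) = to T a , to T b

  move-isometric : ∀ T x y → move (T · x) (T · y) ≡ move x y
  move-isometric T (a , b) (a′ , b′) = cong₂ _+_ (isometric T a a′) (isometric T b b′)

  serves-isometric : ∀ T c r → Serves c (from T r) → Serves (T · c) r
  serves-isometric T c r (inj₁ a≡T⁻¹r) = inj₁ (trans (cong (to T) a≡T⁻¹r) (strictlyInverseˡ T r))
  serves-isometric T c r (inj₂ b≡T⁻¹r) = inj₂ (trans (cong (to T) b≡T⁻¹r) (strictlyInverseˡ T r))

  _⊙_ : ∀ {n} → Isometry → Strategy n → Strategy n
  _⊙_ {zero}  T s   = tt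
  _⊙_ {suc n} T s r = reply (T · next t) (serves-isometric T (next t) r (next-serves t)) (T ⊙ rest t)
    where
    t : Reply (from T r) (Strategy n)
    t = s (from T r)

  serveCost-isometric : ∀ {n} T x (s : Strategy n) σ → serveCost (T · x) (T ⊙ s) (map (to T) σ) ≡ serveCost x s σ
  serveCost-isometric T x s []      = refl
  serveCost-isometric T x s (r ∷ σ) rewrite strictlyInverseʳ T r =
    cong₂ _+_ (move-isometric T x (next (s r))) (serveCost-isometric T (next (s r)) (rest (s r)) σ)

  -- The only geometric input: an isometry can bring y onto r while bringing r
  -- towards b, as close as the two distances to r allow.
  Swing : Set
  Swing = ∀ b r y → Σ Isometry λ T → to T y ≡ r × d b (to T r) ≤ absDiff (d b r) (d y r)

  _≼_ : ∀ {n} → (Vec P n → ℕ) → (Vec P n → ℕ) → Set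
  _≼_ {n} f g = Σ (Vec P n ↔ Vec P n) λ π → ∀ σ → f σ ≤ g (Inverse.to π σ)

  module Optimality
    (d-refl     : ∀ x → d x x ≡ 0)
    (d-sym      : ∀ x y → d x y ≡ d y x)
    (d-triangle : ∀ x y z → d x z ≤ d x y + d y z)
    (swing      : Swing)
    where

    move-triangle : ∀ x y z → move x z ≤ move x y + move y z
    move-triangle (a , b) (a′ , b′) (a″ , b″) = ℕ.≤-trans
      (ℕ.+-mono-≤ (d-triangle a a′ a″) (d-triangle b b′ b″))
      (ℕ.≤-reflexive (interchange (d a a′) (d a′ a″) (d b b′) (d b′ b″)))

    serveCost-≤-move+serveCost : ∀ {n} z w (s : Strategy n) τ → serveCost z s τ ≤ move z w + serveCost w s τ
    serveCost-≤-move+serveCost z w s []      = z≤n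
    serveCost-≤-move+serveCost z w s (r ∷ τ) = begin
      move z c + serveCost c (rest (s r)) τ                ≤⟨ ℕ.+-monoˡ-≤ _ (move-triangle z w c) ⟩
      (move z w + move w c) + serveCost c (rest (s r)) τ   ≡⟨ ℕ.+-assoc (move z w) (move w c) _ ⟩
      move z w + (move w c + serveCost c (rest (s r)) τ)   ∎
      where
      open ℕ.≤-Reasoning
      c : Conf
      c = next (s r)

    swing-exchange : ∀ a b r y → d a r ≤ d b r →
      Σ Isometry λ T → to T y ≡ r × d a r + d b (to T r) ≤ d a y + d b r
    swing-exchange a b r y ar≤br with swing b r y
    ... | T , Ty≡r , b-Tr≤∣br-yr∣ = T , Ty≡r , ℕ.≤-trans (ℕ.+-monoʳ-≤ (d a r) b-Tr≤∣br-yr∣) bound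
      where
      open ℕ.≤-Reasoning
      bound : d a r + absDiff (d b r) (d y r) ≤ d a y + d b r
      bound with ℕ.≤-total (d b r) (d y r)
      ... | inj₁ br≤yr = begin
        d a r + absDiff (d b r) (d y r)  ≡⟨ cong (_+_ (d a r)) (absDiff-≤ br≤yr) ⟩
        d a r + (d y r ∸ d b r)          ≤⟨ ℕ.+-monoˡ-≤ _ ar≤br ⟩
        d b r + (d y r ∸ d b r)          ≡⟨ ℕ.m+[n∸m]≡n br≤yr ⟩
        d y r                            ≤⟨ d-triangle y a r ⟩
        d y a + d a r                    ≤⟨ ℕ.+-mono-≤ (ℕ.≤-reflexive (d-sym y a)) ar≤br ⟩
        d a y + d b r                    ∎
      ... | inj₂ yr≤br = begin
        d a r + absDiff (d b r) (d y r)  ≡⟨ cong (_+_ (d a r)) (absDiff-≥ yr≤br) ⟩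
        d a r + (d b r ∸ d y r)          ≤⟨ ℕ.+-monoˡ-≤ _ (d-triangle a y r) ⟩
        d a y + d y r + (d b r ∸ d y r)  ≡⟨ ℕ.+-assoc (d a y) (d y r) _ ⟩
        d a y + (d y r + (d b r ∸ d y r)) ≡⟨ cong (_+_ (d a y)) (ℕ.m+[n∸m]≡n yr≤br) ⟩
        d a y + d b r                    ∎

    move-via-first : ∀ a b r c → move (a , b) (r , b) + move (r , b) (r , c) ≡ d a r + d b c
    move-via-first a b r c = begin
      (d a r + d b b) + (d r r + d b c)  ≡⟨ cong₂ (λ u v → (d a r + u) + (v + d b c)) (d-refl b) (d-refl r) ⟩
      (d a r + 0) + d b c                ≡⟨ cong (_+ d b c) (ℕ.+-identityʳ (d a r)) ⟩
      d a r + d b c                      ∎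
      where open ≡-Reasoning

    move-via-second : ∀ a b r c → move (a , b) (a , r) + move (a , r) (c , r) ≡ d a c + d b r
    move-via-second a b r c = begin
      (d a a + d b r) + (d a c + d r r)  ≡⟨ cong₂ (λ u v → (u + d b r) + (d a c + v)) (d-refl a) (d-refl r) ⟩
      d b r + (d a c + 0)                ≡⟨ cong (_+_ (d b r)) (ℕ.+-identityʳ (d a c)) ⟩
      d b r + d a c                      ≡⟨ ℕ.+-comm (d b r) (d a c) ⟩
      d a c + d b r                      ∎
      where open ≡-Reasoning

    greedy-exchange : ∀ x r z y → GreedyMove x r z → Serves y r →
      Σ Isometry λ T → move x z + move z (T · y) ≤ move x y
    greedy-exchange (a , b) r _ (_ , y₂) (inj₁ (_ , refl)) (inj₁ refl) =
      id-isometry , ℕ.≤-reflexive (move-via-first a b r y₂)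
    greedy-exchange (a , b) r _ (y₁ , _) (inj₂ (_ , refl)) (inj₂ refl) =
      id-isometry , ℕ.≤-reflexive (move-via-second a b r y₁)
    greedy-exchange (a , b) r _ (y₁ , _) (inj₁ (ar≤br , refl)) (inj₂ refl)
      with swing-exchange a b r y₁ ar≤br
    ... | T , Ty₁≡r , bound = T , via-swing
      where
      via-swing : move (a , b) (r , b) + move (r , b) (T · (y₁ , r)) ≤ d a y₁ + d b r
      via-swing rewrite Ty₁≡r = ℕ.≤-trans (ℕ.≤-reflexive (move-via-first a b r (to T r))) bound
    greedy-exchange (a , b) r _ (_ , y₂) (inj₂ (br≤ar , refl)) (inj₁ refl)
      with swing-exchange b a r y₂ br≤ar
    ... | T , Ty₂≡r , bound = T , via-swing
      where
      open ℕ.≤-Reasoning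
      via-swing : move (a , b) (a , r) + move (a , r) (T · (r , y₂)) ≤ d a r + d b y₂
      via-swing rewrite Ty₂≡r = begin
        move (a , b) (a , r) + move (a , r) (to T r , r)  ≡⟨ move-via-second a b r (to T r) ⟩
        d a (to T r) + d b r                              ≡⟨ ℕ.+-comm (d a (to T r)) (d b r) ⟩
        d b r + d a (to T r)                              ≤⟨ bound ⟩
        d b y₂ + d a r                                    ≡⟨ ℕ.+-comm (d b y₂) (d a r) ⟩
        d a r + d b y₂                                    ∎

    greedy-step-≼ : ∀ {n x r z y} {g s : Strategy n} → GreedyMove x r z → Serves y r →
      (∀ T → serveCost z g ≼ serveCost z (T ⊙ s)) →
      (λ σ → move x z + serveCost z g σ) ≼ (λ σ → move x y + serveCost y s σ)
    greedy-step-≼ {x = x} {r} {z} {y} {g} {s} greedy-move y-serves ih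
      with greedy-exchange x r z y greedy-move y-serves
    ... | T , exchange-bound with ih T
    ...   | π , bound = map-↔ (↔-sym (bijection T)) ↔-∘ π , λ σ → let τ = Inverse.to π σ in begin
      move x z + serveCost z g σ
        ≤⟨ ℕ.+-monoʳ-≤ (move x z) (bound σ) ⟩
      move x z + serveCost z (T ⊙ s) τ
        ≤⟨ ℕ.+-monoʳ-≤ (move x z) (serveCost-≤-move+serveCost z (T · y) (T ⊙ s) τ) ⟩
      move x z + (move z (T · y) + serveCost (T · y) (T ⊙ s) τ)
        ≡⟨ ℕ.+-assoc (move x z) (move z (T · y)) _ ⟨
      move x z + move z (T · y) + serveCost (T · y) (T ⊙ s) τ
        ≤⟨ ℕ.+-monoˡ-≤ _ exchange-bound ⟩
      move x y + serveCost (T · y) (T ⊙ s) τ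
        ≡⟨ cong (_+_ (move x y)) (untransport τ) ⟩
      move x y + serveCost y s (map (from T) τ)
        ∎
      where
      open ℕ.≤-Reasoning
      untransport : ∀ τ → serveCost (T · y) (T ⊙ s) τ ≡ serveCost y s (map (from T) τ)
      untransport τ = begin-equality
        serveCost (T · y) (T ⊙ s) τ
          ≡⟨ cong (serveCost (T · y) (T ⊙ s)) (map-inverse (strictlyInverseˡ T) τ) ⟨
        serveCost (T · y) (T ⊙ s) (map (to T) (map (from T) τ))
          ≡⟨ serveCost-isometric T y s (map (from T) τ) ⟩
        serveCost y s (map (from T) τ)
          ∎

    greedy-≼ : ∀ {n} x (g : Strategy n) → Greedy x g → (s : Strategy n) → serveCost x g ≼ serveCost x s
    greedy-≼ {zero}  x g _      s = ↔-id _ , λ { [] → z≤n }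
    greedy-≼ {suc n} x g greedy s = ∷-↔ (proj₁ ∘ first-request) , λ { (r ∷ σ) → proj₂ (first-request r) σ }
      where
      first-request : ∀ r → (λ σ → serveCost x g (r ∷ σ)) ≼ (λ σ → serveCost x s (r ∷ σ))
      first-request r = greedy-step-≼ (proj₁ (greedy r)) (next-serves (s r))
        (λ T → greedy-≼ (next (g r)) (rest (g r)) (proj₂ (greedy r)) (T ⊙ rest (s r)))

-- Integers modulo M and the discrete circle

open import Data.Integer using (_+_; _*_)

∣m⊖n∣≡absDiff : ∀ m n → ∣ m ⊖ n ∣ ≡ absDiff m n
∣m⊖n∣≡absDiff m n with ℕ.≤-total m n
... | inj₁ m≤n = trans (ℤ.∣⊖∣-≤ m≤n) (sym (absDiff-≤ m≤n))
... | inj₂ n≤m = trans (ℤ.∣m⊖n∣≡∣n⊖m∣ m n) (trans (ℤ.∣⊖∣-≤ n≤m) (sym (absDiff-≥ n≤m)))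

∣[+m]-[+n]∣≡absDiff : ∀ m n → ∣ + m - + n ∣ ≡ absDiff m n
∣[+m]-[+n]∣≡absDiff m n = trans (cong ∣_∣ (ℤ.[+m]-[+n]≡m⊖n m n)) (∣m⊖n∣≡absDiff m n)

∣i∓j∣≡absDiff : ∀ i j → ∣ i - j ∣ ≡ absDiff (∣ i ∣) (∣ j ∣) ⊎ ∣ i + j ∣ ≡ absDiff (∣ i ∣) (∣ j ∣)
∣i∓j∣≡absDiff (+ m)    (+ n)    = inj₁ (∣[+m]-[+n]∣≡absDiff m n)
∣i∓j∣≡absDiff -[1+ m ] -[1+ n ] = inj₁ (trans (cong ∣_∣ (ℤ.[1+m]⊖[1+n]≡m⊖n n m))
                                              (trans (∣m⊖n∣≡absDiff n m) (absDiff-comm n m)))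
∣i∓j∣≡absDiff (+ m)    -[1+ n ] = inj₂ (∣m⊖n∣≡absDiff m (suc n))
∣i∓j∣≡absDiff -[1+ m ] (+ n)    = inj₂ (trans (∣m⊖n∣≡absDiff n (suc m)) (absDiff-comm n (suc m)))

infix 4 _≡_mod_
record _≡_mod_ (i j : ℤ) (m : ℕ) : Set where
  constructor divides
  field
    quotient : ℤ
    equality : i - j ≡ quotient * + m

module _ {m : ℕ} where

  ≡-mod-refl : ∀ i → i ≡ i mod m
  ≡-mod-refl i = divides 0ℤ (ℤ.+-inverseʳ i)

  ≡⇒≡-mod : ∀ {i j} → i ≡ j → i ≡ j mod m
  ≡⇒≡-mod {i} refl = ≡-mod-refl i

  ≡+*⇒≡-mod : ∀ {i j} k → i ≡ j + k * + m → i ≡ j mod m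
  ≡+*⇒≡-mod {j = j} k refl = divides k (cancel j (k * + m))
    where
    cancel : ∀ j l → j + l - j ≡ l
    cancel = solve-∀

  ≡-mod-sym : ∀ {i j} → i ≡ j mod m → j ≡ i mod m
  ≡-mod-sym {i} {j} (divides k i-j≡km) = divides (- k) (begin
    j - i        ≡⟨ swap i j ⟩
    - (i - j)    ≡⟨ cong -_ i-j≡km ⟩
    - (k * + m)  ≡⟨ ℤ.neg-distribˡ-* k (+ m) ⟩
    - k * + m    ∎)
    where
    open ≡-Reasoning
    swap : ∀ i j → j - i ≡ - (i - j)
    swap = solve-∀

  ≡-mod-trans : ∀ {i j l} → i ≡ j mod m → j ≡ l mod m → i ≡ l mod m
  ≡-mod-trans {i} {j} {l} (divides k i-j≡km) (divides k′ j-l≡k′m) = divides (k + k′) (begin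
    i - l                ≡⟨ telescope i j l ⟩
    (i - j) + (j - l)    ≡⟨ cong₂ _+_ i-j≡km j-l≡k′m ⟩
    k * + m + k′ * + m   ≡⟨ ℤ.*-distribʳ-+ (+ m) k k′ ⟨
    (k + k′) * + m       ∎)
    where
    open ≡-Reasoning
    telescope : ∀ i j l → i - l ≡ (i - j) + (j - l)
    telescope = solve-∀

  +-cong-mod : ∀ {i j i′ j′} → i ≡ j mod m → i′ ≡ j′ mod m → i + i′ ≡ j + j′ mod m
  +-cong-mod {i} {j} {i′} {j′} (divides k i-j≡km) (divides k′ i′-j′≡k′m) = divides (k + k′) (begin
    (i + i′) - (j + j′)  ≡⟨ regroup i j i′ j′ ⟩
    (i - j) + (i′ - j′)  ≡⟨ cong₂ _+_ i-j≡km i′-j′≡k′m ⟩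
    k * + m + k′ * + m   ≡⟨ ℤ.*-distribʳ-+ (+ m) k k′ ⟨
    (k + k′) * + m       ∎)
    where
    open ≡-Reasoning
    regroup : ∀ i j i′ j′ → (i + i′) - (j + j′) ≡ (i - j) + (i′ - j′)
    regroup = solve-∀

  neg-cong-mod : ∀ {i j} → i ≡ j mod m → - i ≡ - j mod m
  neg-cong-mod {i} {j} (divides k i-j≡km) = divides (- k) (begin
    - i - - j    ≡⟨ negate i j ⟩
    - (i - j)    ≡⟨ cong -_ i-j≡km ⟩
    - (k * + m)  ≡⟨ ℤ.neg-distribˡ-* k (+ m) ⟩
    - k * + m    ∎)
    where
    open ≡-Reasoning
    negate : ∀ i j → - i - - j ≡ - (i - j)
    negate = solve-∀

  minus-cong-mod : ∀ {i j i′ j′} → i ≡ j mod m → i′ ≡ j′ mod m → i - i′ ≡ j - j′ mod m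
  minus-cong-mod i≡j i′≡j′ = +-cong-mod i≡j (neg-cong-mod i′≡j′)

≡-mod-setoid : ℕ → Setoid _ _
≡-mod-setoid m = record
  { Carrier = ℤ
  ; _≈_ = λ i j → i ≡ j mod m
  ; isEquivalence = record
    { refl = λ {i} → ≡-mod-refl i
    ; sym = λ {i j} → ≡-mod-sym {i = i} {j}
    ; trans = λ {i j l} → ≡-mod-trans {i = i} {j} {l} } }

module Cycle (N : ℕ) where

  M : ℕ
  M = suc N

  ι : Fin M → ℤ
  ι p = + toℕ p

  module ≡-mod-Reasoning = SetoidReasoning (≡-mod-setoid M)

  lineDist : Fin M → Fin M → ℕ
  lineDist p q = absDiff (toℕ p) (toℕ q)

  ∣ι-ι∣≡lineDist : ∀ p q → ∣ ι p - ι q ∣ ≡ lineDist p q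
  ∣ι-ι∣≡lineDist p q = ∣[+m]-[+n]∣≡absDiff (toℕ p) (toℕ q)

  ∣ι-ι∣<M : ∀ p q → ∣ ι p - ι q ∣ ℕ.< M
  ∣ι-ι∣<M p q = subst (ℕ._< M) (sym (∣ι-ι∣≡lineDist p q)) (absDiff-< (Fin.toℕ<n p) (Fin.toℕ<n q))

  multiple-zero-or-large : ∀ k → k ≡ 0ℤ ⊎ M ℕ.≤ ∣ k * + M ∣
  multiple-zero-or-large k with ℤ.∣i*j∣≡∣i∣*∣j∣ k (+ M)
  ... | ∣kM∣≡∣k∣M with k
  ...   | + zero   = inj₁ refl
  ...   | +[1+ n ] = inj₂ (subst (M ℕ.≤_) (sym ∣kM∣≡∣k∣M) (ℕ.m≤m+n M (n ℕ.* M)))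
  ...   | -[1+ n ] = inj₂ (subst (M ℕ.≤_) (sym ∣kM∣≡∣k∣M) (ℕ.m≤m+n M (n ℕ.* M)))

  ι-injective-mod : ∀ {p q} → ι p ≡ ι q mod M → p ≡ q
  ι-injective-mod {p} {q} (divides k ιp-ιq≡kM) with multiple-zero-or-large k
  ... | inj₁ refl = Fin.toℕ-injective (ℤ.+-injective (ℤ.i-j≡0⇒i≡j (ι p) (ι q) ιp-ιq≡kM))
  ... | inj₂ M≤∣kM∣ = ⊥-elim (ℕ.<⇒≱ (∣ι-ι∣<M p q) (subst (M ℕ.≤_) (cong ∣_∣ (sym ιp-ιq≡kM)) M≤∣kM∣))

  reduce : ℤ → Fin M
  reduce i = fromℕ< (n%ℕd<d i M)

  ι-reduce : ∀ i → ι (reduce i) ≡ i mod M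
  ι-reduce i = begin
    ι (reduce i)   ≡⟨ cong +_ (Fin.toℕ-fromℕ< (n%ℕd<d i M)) ⟩
    + (i %ℕ M)     ≈⟨ ≡+*⇒≡-mod (i /ℕ M) (a≡a%ℕn+[a/ℕn]*n i M) ⟨
    i              ∎
    where open ≡-mod-Reasoning

  cdist-≤ : ∀ p q {e} → e ≡ ι p - ι q mod M → cdist p q ℕ.≤ ∣ e ∣
  cdist-≤ p q {e} (divides k e-[ιp-ιq]≡kM) with multiple-zero-or-large k
  ... | inj₁ refl = begin
    cdist p q      ≤⟨ ℕ.m⊓n≤m D (M ∸ D) ⟩
    D              ≡⟨ ∣ι-ι∣≡lineDist p q ⟨
    ∣ ι p - ι q ∣  ≡⟨ cong ∣_∣ (ℤ.i-j≡0⇒i≡j e _ e-[ιp-ιq]≡kM) ⟨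
    ∣ e ∣          ∎
    where
    open ℕ.≤-Reasoning
    D : ℕ
    D = lineDist p q
  ... | inj₂ M≤∣kM∣ = ℕ.≤-trans (ℕ.m⊓n≤n D (M ∸ D)) (ℕ.m≤n+o⇒m∸n≤o M D (begin
    M                            ≤⟨ M≤∣kM∣ ⟩
    ∣ k * + M ∣                  ≡⟨ cong ∣_∣ e-[ιp-ιq]≡kM ⟨
    ∣ e - (ι p - ι q) ∣          ≤⟨ ℤ.∣i-j∣≤∣i∣+∣j∣ e (ι p - ι q) ⟩
    ∣ e ∣ ℕ.+ ∣ ι p - ι q ∣      ≡⟨ cong (∣ e ∣ ℕ.+_) (∣ι-ι∣≡lineDist p q) ⟩
    ∣ e ∣ ℕ.+ D                  ≡⟨ ℕ.+-comm ∣ e ∣ D ⟩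
    D ℕ.+ ∣ e ∣                  ∎))
    where
    open ℕ.≤-Reasoning
    D : ℕ
    D = lineDist p q

  complementary-representative : ∀ i → ∣ i ∣ ℕ.≤ M → ∃[ e ] e ≡ i mod M × ∣ e ∣ ≡ M ∸ ∣ i ∣
  complementary-representative (+ n) n≤M =
    + n - + M , ≡+*⇒≡-mod -1ℤ (subtract (+ n) (+ M))
    , trans (cong ∣_∣ (ℤ.[+m]-[+n]≡m⊖n n M)) (ℤ.∣⊖∣-≤ n≤M)
    where
    subtract : ∀ i m → i - m ≡ i + -1ℤ * m
    subtract = solve-∀
  complementary-representative -[1+ n ] n<M =
    -[1+ n ] + + M , ≡+*⇒≡-mod {j = -[1+ n ]} 1ℤ (cong (ℤ._+_ -[1+ n ]) (sym (ℤ.*-identityˡ (+ M))))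
    , trans (ℤ.∣m⊖n∣≡∣n⊖m∣ M (suc n)) (ℤ.∣⊖∣-≤ n<M)

  cdist-attained : ∀ p q → ∃[ e ] e ≡ ι p - ι q mod M × cdist p q ≡ ∣ e ∣
  cdist-attained p q with lineDist p q ℕ.≤? M ∸ lineDist p q
  ... | yes D≤M-D = ι p - ι q , ≡-mod-refl (ι p - ι q) , trans (ℕ.m≤n⇒m⊓n≡m D≤M-D) (sym (∣ι-ι∣≡lineDist p q))
  ... | no D≰M-D with complementary-representative (ι p - ι q) (ℕ.<⇒≤ (∣ι-ι∣<M p q))
  ...   | e , e≡ , ∣e∣≡M-∣ιp-ιq∣ = e , e≡ , (begin
    cdist p q                ≡⟨ ℕ.m≥n⇒m⊓n≡n (ℕ.<⇒≤ (ℕ.≰⇒> D≰M-D)) ⟩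
    M ∸ lineDist p q         ≡⟨ cong (M ∸_) (∣ι-ι∣≡lineDist p q) ⟨
    M ∸ ∣ ι p - ι q ∣        ≡⟨ ∣e∣≡M-∣ιp-ιq∣ ⟨
    ∣ e ∣                    ∎)
    where open ≡-Reasoning

  cdist-mono-mod : ∀ p q p′ q′ → ι p - ι q ≡ ι p′ - ι q′ mod M → cdist p q ℕ.≤ cdist p′ q′
  cdist-mono-mod p q p′ q′ δ≡δ′ with cdist-attained p′ q′
  ... | e , e≡δ′ , cdist≡∣e∣ = subst (_ ℕ.≤_) (sym cdist≡∣e∣) (cdist-≤ p q (≡-mod-trans e≡δ′ (≡-mod-sym δ≡δ′)))

  cdist-cong-mod : ∀ p q p′ q′ → ι p - ι q ≡ ι p′ - ι q′ mod M → cdist p q ≡ cdist p′ q′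
  cdist-cong-mod p q p′ q′ δ≡δ′ =
    ℕ.≤-antisym (cdist-mono-mod p q p′ q′ δ≡δ′) (cdist-mono-mod p′ q′ p q (≡-mod-sym δ≡δ′))

  cdist-refl : ∀ (p : Fin M) → cdist p p ≡ 0
  cdist-refl p rewrite ℕ.n∸n≡0 (toℕ p) = refl

  cdist-sym : ∀ (p q : Fin M) → cdist p q ≡ cdist q p
  cdist-sym p q = cong (λ D → D ⊓ (M ∸ D)) (absDiff-comm (toℕ p) (toℕ q))

  cdist-triangle : ∀ (p q r : Fin M) → cdist p r ℕ.≤ cdist p q ℕ.+ cdist q r
  cdist-triangle p q r with cdist-attained p q | cdist-attained q r
  ... | e , e≡ , cdist-pq≡∣e∣ | e′ , e′≡ , cdist-qr≡∣e′∣ = begin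
    cdist p r              ≤⟨ cdist-≤ p r (≡-mod-trans (+-cong-mod e≡ e′≡) (≡⇒≡-mod (telescope (ι p) (ι q) (ι r)))) ⟩
    ∣ e + e′ ∣             ≤⟨ ℤ.∣i+j∣≤∣i∣+∣j∣ e e′ ⟩
    ∣ e ∣ ℕ.+ ∣ e′ ∣       ≡⟨ cong₂ ℕ._+_ cdist-pq≡∣e∣ cdist-qr≡∣e′∣ ⟨
    cdist p q ℕ.+ cdist q r ∎
    where
    open ℕ.≤-Reasoning
    telescope : ∀ i j l → (i - j) + (j - l) ≡ i - l
    telescope = solve-∀

  open TwoServers (cdist {M})

  rotate : ℤ → Fin M → Fin M
  rotate c p = reduce (ι p + c)

  rotate-inverse : ∀ c c′ p → c + c′ ≡ 0ℤ → rotate c′ (rotate c p) ≡ p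
  rotate-inverse c c′ p c+c′≡0 = ι-injective-mod (begin
    ι (rotate c′ (rotate c p))  ≈⟨ ι-reduce (ι (rotate c p) + c′) ⟩
    ι (rotate c p) + c′         ≈⟨ +-cong-mod (ι-reduce (ι p + c)) (≡-mod-refl c′) ⟩
    ι p + c + c′                ≡⟨ ℤ.+-assoc (ι p) c c′ ⟩
    ι p + (c + c′)              ≡⟨ cong (_+_ (ι p)) c+c′≡0 ⟩
    ι p + 0ℤ                    ≡⟨ ℤ.+-identityʳ (ι p) ⟩
    ι p                         ∎)
    where open ≡-mod-Reasoning

  rotate-displacement : ∀ c p q → ι (rotate c p) - ι (rotate c q) ≡ ι p - ι q mod M
  rotate-displacement c p q = begin
    ι (rotate c p) - ι (rotate c q)  ≈⟨ minus-cong-mod (ι-reduce (ι p + c)) (ι-reduce (ι q + c)) ⟩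
    (ι p + c) - (ι q + c)            ≡⟨ cancel (ι p) (ι q) c ⟩
    ι p - ι q                        ∎
    where
    open ≡-mod-Reasoning
    cancel : ∀ i j c → (i + c) - (j + c) ≡ i - j
    cancel = solve-∀

  rotation : ℤ → Isometry
  rotation c = record
    { bijection = mk↔ₛ′ (rotate c) (rotate (- c))
        (λ p → rotate-inverse (- c) c p (ℤ.+-inverseˡ c))
        (λ p → rotate-inverse c (- c) p (ℤ.+-inverseʳ c))
    ; isometric = λ p q → cdist-cong-mod (rotate c p) (rotate c q) p q (rotate-displacement c p q)
    }

  reflect : ℤ → Fin M → Fin M
  reflect c p = reduce (c - ι p)

  reflect-involutive : ∀ c p → reflect c (reflect c p) ≡ p
  reflect-involutive c p = ι-injective-mod (begin
    ι (reflect c (reflect c p))  ≈⟨ ι-reduce (c - ι (reflect c p)) ⟩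
    c - ι (reflect c p)          ≈⟨ minus-cong-mod (≡-mod-refl c) (ι-reduce (c - ι p)) ⟩
    c - (c - ι p)                ≡⟨ cancel c (ι p) ⟩
    ι p                          ∎)
    where
    open ≡-mod-Reasoning
    cancel : ∀ c i → c - (c - i) ≡ i
    cancel = solve-∀

  reflect-displacement : ∀ c p q → ι (reflect c p) - ι (reflect c q) ≡ ι q - ι p mod M
  reflect-displacement c p q = begin
    ι (reflect c p) - ι (reflect c q)  ≈⟨ minus-cong-mod (ι-reduce (c - ι p)) (ι-reduce (c - ι q)) ⟩
    (c - ι p) - (c - ι q)              ≡⟨ cancel c (ι p) (ι q) ⟩
    ι q - ι p                          ∎
    where
    open ≡-mod-Reasoning
    cancel : ∀ c i j → (c - i) - (c - j) ≡ j - i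
    cancel = solve-∀

  reflection : ℤ → Isometry
  reflection c = record
    { bijection = mk↔ₛ′ (reflect c) (reflect c) (reflect-involutive c) (reflect-involutive c)
    ; isometric = λ p q → trans (cdist-cong-mod (reflect c p) (reflect c q) q p (reflect-displacement c p q)) (cdist-sym q p)
    }

  reflect-swaps : ∀ y r → reflect (ι y + ι r) y ≡ r
  reflect-swaps y r = ι-injective-mod (begin
    ι (reflect (ι y + ι r) y)  ≈⟨ ι-reduce ((ι y + ι r) - ι y) ⟩
    (ι y + ι r) - ι y          ≡⟨ cancel (ι y) (ι r) ⟩
    ι r                        ∎)
    where
    open ≡-mod-Reasoning
    cancel : ∀ i j → (i + j) - i ≡ j
    cancel = solve-∀

  rotate-aligns : ∀ y r → rotate (ι r - ι y) y ≡ r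
  rotate-aligns y r = ι-injective-mod (begin
    ι (rotate (ι r - ι y) y)  ≈⟨ ι-reduce (ι y + (ι r - ι y)) ⟩
    ι y + (ι r - ι y)         ≡⟨ cancel (ι y) (ι r) ⟩
    ι r                       ∎)
    where
    open ≡-mod-Reasoning
    cancel : ∀ i j → i + (j - i) ≡ j
    cancel = solve-∀

  reflect-swing : ∀ b r y {β η} → β ≡ ι b - ι r mod M → η ≡ ι y - ι r mod M →
    cdist b (reflect (ι y + ι r) r) ℕ.≤ ∣ β - η ∣
  reflect-swing b r y {β} {η} β≡ η≡ = cdist-≤ b (reflect (ι y + ι r) r) (begin
    β - η                            ≈⟨ minus-cong-mod β≡ η≡ ⟩
    (ι b - ι r) - (ι y - ι r)        ≡⟨ regroup (ι b) (ι y) (ι r) ⟩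
    ι b - ((ι y + ι r) - ι r)        ≈⟨ minus-cong-mod (≡-mod-refl (ι b)) (ι-reduce ((ι y + ι r) - ι r)) ⟨
    ι b - ι (reflect (ι y + ι r) r)  ∎)
    where
    open ≡-mod-Reasoning
    regroup : ∀ b y r → (b - r) - (y - r) ≡ b - ((y + r) - r)
    regroup = solve-∀

  rotate-swing : ∀ b r y {β η} → β ≡ ι b - ι r mod M → η ≡ ι y - ι r mod M →
    cdist b (rotate (ι r - ι y) r) ℕ.≤ ∣ β + η ∣
  rotate-swing b r y {β} {η} β≡ η≡ = cdist-≤ b (rotate (ι r - ι y) r) (begin
    β + η                            ≈⟨ +-cong-mod β≡ η≡ ⟩
    (ι b - ι r) + (ι y - ι r)        ≡⟨ regroup (ι b) (ι y) (ι r) ⟩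
    ι b - (ι r + (ι r - ι y))        ≈⟨ minus-cong-mod (≡-mod-refl (ι b)) (ι-reduce (ι r + (ι r - ι y))) ⟨
    ι b - ι (rotate (ι r - ι y) r)   ∎)
    where
    open ≡-mod-Reasoning
    regroup : ∀ b y r → (b - r) + (y - r) ≡ b - (r + (r - y))
    regroup = solve-∀

  -- With signed representatives β and η of the displacements of b and y from
  -- r: when they have equal signs, the reflection swapping y and r brings r
  -- within ∣β - η∣ of b; otherwise the rotation taking y to r brings r within
  -- ∣β + η∣ of b.
  swing : Swing
  swing b r y with cdist-attained b r | cdist-attained y r
  ... | β , β≡ , br≡∣β∣ | η , η≡ , yr≡∣η∣ = choose (∣i∓j∣≡absDiff β η)
    where
    target : ℕ
    target = absDiff (cdist b r) (cdist y r)

    bound : ∀ {k e} → k ℕ.≤ e → e ≡ absDiff (∣ β ∣) (∣ η ∣) → k ℕ.≤ target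
    bound k≤e e≡ = subst (_ ℕ.≤_) (trans e≡ (sym (cong₂ absDiff br≡∣β∣ yr≡∣η∣))) k≤e

    choose : ∣ β - η ∣ ≡ absDiff (∣ β ∣) (∣ η ∣) ⊎ ∣ β + η ∣ ≡ absDiff (∣ β ∣) (∣ η ∣) →
      Σ Isometry λ T → to T y ≡ r × cdist b (to T r) ℕ.≤ target
    choose (inj₁ ∣β-η∣≡) = reflection (ι y + ι r) , reflect-swaps y r , bound (reflect-swing b r y β≡ η≡) ∣β-η∣≡
    choose (inj₂ ∣β+η∣≡) = rotation (ι r - ι y) , rotate-aligns y r , bound (rotate-swing b r y β≡ η≡) ∣β+η∣≡

module Strategies (N : ℕ) where

  open TwoServers (cdist {suc N})

  strategy : Online (suc N) → List (Fin (suc N)) → (n : ℕ) → Strategy n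
  strategy A past zero      = tt
  strategy A past (suc n) r = reply (step A past r) (serves A past r) (strategy A (r ∷ past) n)

  runCost≡serveCost : ∀ A c0 past {n} (σ : Vec (Fin (suc N)) n) →
    runCost A c0 past σ ≡ serveCost (conf A c0 past) (strategy A past n) σ
  runCost≡serveCost A c0 past []      = refl
  runCost≡serveCost A c0 past (r ∷ σ) =
    cong (moveCost (conf A c0 past) (step A past r) ℕ.+_) (runCost≡serveCost A c0 (r ∷ past) σ)

  strategy-greedy : ∀ G c0 → IsGreedy G c0 → ∀ past n → Greedy (conf G c0 past) (strategy G past n)
  strategy-greedy G c0 G-greedy past zero      = tt
  strategy-greedy G c0 G-greedy past (suc n) r = G-greedy past r , strategy-greedy G c0 G-greedy (r ∷ past) n

theorem2 : (N : ℕ) (c0 : Config (suc N)) (G : Online (suc N)) → IsGreedy G c0 →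
    (B : Online (suc N)) (n : ℕ) →
    Σ (Vec (Fin (suc N)) n ↔ Vec (Fin (suc N)) n) λ π →
      ∀ σ → cost G c0 σ ≤ cost B c0 (Inverse.to π σ)
theorem2 N c0 G G-greedy B n =
  let π , bound = greedy-≼ c0 (strategy G [] n) (strategy-greedy G c0 G-greedy [] n) (strategy B [] n)
  in π , λ σ → begin
    cost G c0 σ                                      ≡⟨ runCost≡serveCost G c0 [] σ ⟩
    serveCost c0 (strategy G [] n) σ                 ≤⟨ bound σ ⟩
    serveCost c0 (strategy B [] n) (Inverse.to π σ)  ≡⟨ runCost≡serveCost B c0 [] (Inverse.to π σ) ⟨
    cost B c0 (Inverse.to π σ)                       ∎
  where
  open Cycle N
  open Strategies N
  open TwoServers (cdist {suc N})
  open Optimality cdist-refl cdist-sym cdist-triangle swing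
  open ℕ.≤-Reasoning
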